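{- For every multilinear tableau $T$, the number of set partitions $\mathcal{A}$ of $\mathrm{supp}(T)$ with $\mathcal{T}(\mathcal{A})=T$ equals $c(T)$.
   Context: A multilinear tableau of shape $\lambda=(\lambda_1,\dots,\lambda_m)$ is an array $T=(T_{ij})_{1\le i\le m,1\le j\le\lambda_i}$ of distinct positive integers whose rows increase left to right and columns increase top to bottom; $\mathrm{supp}(T)$ is its set of entries. For $1\le i\le m$ and $2\le j\le\lambda_i$, $c_{ij}(T)=\#\{i'\ge i:\text{cell }(i',j-1)\text{ exists and }T_{i',j-1}<T_{ij}\}$ and $c(T)=\prod_{i=1}^m\prod_{j=2}^{\lambda_i}c_{ij}(T)$. For a set partition $\mathcal{A}$ of a finite set $S\subset\mathbb{N}$ with blocks $A_1,\dots,A_m$ listed in increasing order of least elements, $\mathcal{T}(\mathcal{A})$ is obtained by placing the $j$-th smallest element of $A_i$ in row $i$, column $j$, and then sorting each column into increasing order and top-justifying it. -}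

module Defs where

open import Data.Nat using (ℕ; zero; suc; _<_; _≤_; _≥_; _<ᵇ_; _∸_)
open import Data.Nat.Base using (_⊔_)
open import Data.Bool using (Bool; true; false; if_then_else_)
open import Data.Maybe using (Maybe; just; nothing; maybe)
open import Data.List using (List; []; _∷_; map; concat; length; upTo; drop; mapMaybe)
open import Data.Nat.ListAction using (product)
open import Data.List.Relation.Unary.All using (All)
open import Data.List.Relation.Unary.Linked using (Linked)
open import Data.List.Relation.Unary.Unique.Propositional using (Unique)
open import Data.List.Relation.Binary.Permutation.Propositional using (_↭_)
open import Data.Product using (_×_)
open import Relation.Binary.PropositionalEquality using (_≡_)

-- Conventions.  A tableau is given by its list of rows (row 1 first);
-- all indices below are 0-based.

at : {A : Set} → List A → ℕ → Maybe A
at []       _       = nothing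
at (x ∷ xs) zero    = just x
at (x ∷ xs) (suc i) = at xs i

entry : List (List ℕ) → ℕ → ℕ → Maybe ℕ
entry T i j = maybe (λ r → at r j) nothing (at T i)

data NonEmpty {A : Set} : List A → Set where
  nonEmpty : ∀ {x xs} → NonEmpty (x ∷ xs)

IsShape : List (List ℕ) → Set
IsShape T = All NonEmpty T × Linked (λ r s → length s ≤ length r) T

supp : List (List ℕ) → List ℕ
supp T = concat T

record MultilinearTableau (T : List (List ℕ)) : Set where
  field
    shape     : IsShape T
    distinct  : Unique (supp T)
    positive  : All (λ x → 0 < x) (supp T)
    rowsIncr  : All (Linked _<_) T
    colsIncr  : ∀ i j x y → entry T i j ≡ just x → entry T (suc i) j ≡ just y → x < y

-- Set partitions of a finite set S (given as a list of its elements),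
-- in canonical form: a list of blocks A_1,...,A_m, each block a nonempty
-- strictly increasing list, blocks listed in strictly increasing order
-- of least elements, whose union is S with every element of S in exactly
-- one block (concatenation is a permutation of S).

headLt : List ℕ → List ℕ → Set
headLt (x ∷ _) (y ∷ _) = x < y
headLt _       _       = Data.Nat._≤_ 0 0

SetPartitionOf : List ℕ → List (List ℕ) → Set
SetPartitionOf S A =
  All NonEmpty A × All (Linked _<_) A × Linked headLt A × (concat A ↭ S)

insert : ℕ → List ℕ → List ℕ
insert x []       = x ∷ []
insert x (y ∷ ys) = if x <ᵇ y then x ∷ y ∷ ys else y ∷ insert x ys

sortℕ : List ℕ → List ℕ
sortℕ []       = []
sortℕ (x ∷ xs) = insert x (sortℕ xs)

maxLen : List (List ℕ) → ℕ
maxLen []       = 0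
maxLen (r ∷ rs) = length r ⊔ maxLen rs

-- column j of the array with rows = blocks, sorted increasingly
-- (and thereby top-justified)
sortedColumn : List (List ℕ) → ℕ → List ℕ
sortedColumn A j = sortℕ (mapMaybe (λ r → at r j) A)

rowsFromColumns : List (List ℕ) → List (List ℕ)
rowsFromColumns C = map (λ i → mapMaybe (λ c → at c i) C) (upTo (maxLen C))

𝒯 : List (List ℕ) → List (List ℕ)
𝒯 A = rowsFromColumns (map (sortedColumn A) (upTo (maxLen A)))

countBelow : List (List ℕ) → ℕ → ℕ → ℕ
countBelow []       k x = 0
countBelow (r ∷ rs) k x =
  maybe (λ v → if v <ᵇ x then suc (countBelow rs k x) else countBelow rs k x)
        (countBelow rs k x) (at r k)

-- c_{ij}(T) for 0-based i and j ≥ 1: #{i' ≥ i : T_{i',j-1} exists and < T_{ij}}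
cij : List (List ℕ) → ℕ → ℕ → ℕ
cij T i j = maybe (λ x → countBelow (drop i T) (j ∸ 1) x) 0 (entry T i j)

rowLen : List (List ℕ) → ℕ → ℕ
rowLen T i = maybe length 0 (at T i)

c : List (List ℕ) → ℕ
c T = product (map (λ i → product (map (λ j → cij T i (suc j)) (upTo (rowLen T i ∸ 1))))
                   (upTo (length T)))

module Submission where

-- Induction on the number of entries.  The largest entry N of T ends its row, which
-- has some length j + 1, all rows below it are shorter, and deleting N leaves a
-- multilinear tableau T′.  Appending N to a block of a set partition 𝒜′ adds N to
-- 𝒯(𝒜′) as a new cell at the end of the column indexed by the old length of that
-- block.  Hence each 𝒜 with 𝒯(𝒜) = T arises exactly once from some 𝒜′ with
-- 𝒯(𝒜′) = T′, by appending N to a block of length j (or as a new block if j = 0).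
-- The blocks of 𝒜′ have the same lengths as the rows of T′, so every 𝒜′ offers as
-- many choices as T′ has rows of length j (plus one if j = 0).  That is the factor
-- of c(T) at the new cell; the other factors only count smaller entries, so they
-- are those of c(T′).

open import Defs
open import Data.Nat using (ℕ; zero; suc; _+_; _*_; _∸_; _≤_; _<_; z≤n; s≤s; _<ᵇ_; _≟_; _≤?_; _⊔_)
open import Data.Nat.Properties
open import Data.Nat.ListAction using (product)
open import Data.Nat.Tactic.RingSolver using (solve-∀)
open import Data.Bool using (true; false; T)
open import Data.Empty using (⊥; ⊥-elim)
open import Data.Maybe using (just; nothing; maybe; maybe′)
open import Data.Product using (_×_; _,_; proj₁; proj₂; map₂; ∃-syntax)
open import Data.Sum using (_⊎_; inj₁; inj₂)
open import Data.Unit using (⊤; tt)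
open import Data.List using (List; []; _∷_; _++_; _∷ʳ_; map; concat; concatMap; length; upTo; applyUpTo; mapMaybe)
open import Data.List.Properties
  using (map-upTo; map-applyUpTo; length-map; length-upTo; length-++; ++-assoc; ∷-injective; ∷ʳ-injectiveˡ)
open import Data.List.Extrema.Nat using (max; xs≤max; ⊥≤max; argmax-sel)
open import Data.List.Membership.Propositional using (_∈_; find; lose)
open import Data.List.Membership.Propositional.Properties
  using (∈-map⁺; ∈-map⁻; ∈-∃++; ∈-concat⁻′; ∈-concatMap⁺; ∈-concatMap⁻)
open import Data.List.Relation.Unary.Any using (here; there)
open import Data.List.Relation.Unary.All as All using (All; []; _∷_)
open import Data.List.Relation.Unary.All.Properties as All using ()
open import Data.List.Relation.Unary.AllPairs as AllPairs using (AllPairs; []; _∷_)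
open import Data.List.Relation.Unary.Linked as Linked using (Linked; []; [-]; _∷_)
open import Data.List.Relation.Unary.Linked.Properties as Linked using ()
open import Data.List.Relation.Unary.Unique.Propositional using (Unique)
open import Data.List.Relation.Unary.Unique.Propositional.Properties as Unique using ()
open import Data.List.Relation.Binary.Permutation.Propositional as Perm
  using (_↭_; ↭-refl; ↭-trans; ↭-sym; ↭-reflexive; prep)
open import Data.List.Relation.Binary.Permutation.Propositional.Properties
  using (shift; ++⁺ˡ; drop-∷; All-resp-↭; ∈-resp-↭; ↭-empty-inv; ↭-length)
import Data.List.Relation.Binary.Permutation.Setoid.Properties as PermSetoid
open import Function using (_∘_; id)
open import Function.Bundles using (_⇔_; mk⇔; Equivalence)
open import Relation.Binary.PropositionalEquality
  using (_≡_; _≢_; refl; sym; trans; cong; cong₂; subst; subst₂; setoid; module ≡-Reasoning)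
open import Relation.Binary.Definitions using (Transitive)
open import Relation.Nullary using (yes; no; contradiction)

module _ {A : Set} where

  at-beyond : ∀ (xs : List A) {i} → length xs ≤ i → at xs i ≡ nothing
  at-beyond []       _           = refl
  at-beyond (x ∷ xs) (s≤s len≤i) = at-beyond xs len≤i

  at-just⇒< : ∀ (xs : List A) i {v} → at xs i ≡ just v → i < length xs
  at-just⇒< (x ∷ xs) zero    _  = s≤s z≤n
  at-just⇒< (x ∷ xs) (suc i) eq = s≤s (at-just⇒< xs i eq)

  <⇒at-just : ∀ (xs : List A) i → i < length xs → ∃[ v ] at xs i ≡ just v
  <⇒at-just (x ∷ xs) zero    _         = x , refl
  <⇒at-just (x ∷ xs) (suc i) (s≤s i<n) = <⇒at-just xs i i<n

  at-nothing-suc : ∀ (xs : List A) i → at xs i ≡ nothing → at xs (suc i) ≡ nothing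
  at-nothing-suc []           _       _  = refl
  at-nothing-suc (x ∷ [])     zero    ()
  at-nothing-suc (x ∷ y ∷ xs) zero    ()
  at-nothing-suc (x ∷ xs)     (suc i) eq = at-nothing-suc xs i eq

  All-at : ∀ {P : A → Set} (xs : List A) i {v} → All P xs → at xs i ≡ just v → P v
  All-at (x ∷ xs) zero    (px ∷ _)  refl = px
  All-at (x ∷ xs) (suc i) (_ ∷ pxs) eq   = All-at xs i pxs eq

  at-∷ʳ-length : ∀ (xs : List A) y → at (xs ∷ʳ y) (length xs) ≡ just y
  at-∷ʳ-length []       y = refl
  at-∷ʳ-length (x ∷ xs) y = at-∷ʳ-length xs y

  at-∷ʳ-≢length : ∀ (xs : List A) y i → i ≢ length xs → at (xs ∷ʳ y) i ≡ at xs i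
  at-∷ʳ-≢length []       y zero    i≢0 = contradiction refl i≢0
  at-∷ʳ-≢length []       y (suc i) _   = refl
  at-∷ʳ-≢length (x ∷ xs) y zero    _   = refl
  at-∷ʳ-≢length (x ∷ xs) y (suc i) i≢n = at-∷ʳ-≢length xs y i (i≢n ∘ cong suc)

  at-∷ʳ : ∀ (xs : List A) y i →
    at (xs ∷ʳ y) i ≡ at xs i ⊎ (at (xs ∷ʳ y) i ≡ just y × at xs i ≡ nothing)
  at-∷ʳ xs y i with i ≟ length xs
  ... | yes refl = inj₂ (at-∷ʳ-length xs y , at-beyond xs ≤-refl)
  ... | no i≢n   = inj₁ (at-∷ʳ-≢length xs y i i≢n)

  length-∷ʳ : ∀ (xs : List A) y → length (xs ∷ʳ y) ≡ suc (length xs)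
  length-∷ʳ []       y = refl
  length-∷ʳ (x ∷ xs) y = cong suc (length-∷ʳ xs y)

  applyUpTo-cong : ∀ {f g : ℕ → A} n → (∀ i → f i ≡ g i) → applyUpTo f n ≡ applyUpTo g n
  applyUpTo-cong zero    f≗g = refl
  applyUpTo-cong (suc n) f≗g = cong₂ _∷_ (f≗g 0) (applyUpTo-cong n (f≗g ∘ suc))

  Unique-resp-↭ : ∀ {xs ys : List A} → xs ↭ ys → Unique xs → Unique ys
  Unique-resp-↭ xs↭ys = PermSetoid.Unique-resp-↭ (setoid A) (Perm.↭⇒↭ₛ xs↭ys)

module _ {A : Set} {R : A → A → Set} where

  Linked-∷⁺ : ∀ {x ys} → All (R x) ys → Linked R ys → Linked R (x ∷ ys)
  Linked-∷⁺ []        _  = [-]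
  Linked-∷⁺ (Rxy ∷ _) lk = Rxy ∷ lk

  Linked-++⁻ˡ : ∀ xs {ys} → Linked R (xs ++ ys) → Linked R xs
  Linked-++⁻ˡ []           _        = []
  Linked-++⁻ˡ (x ∷ [])     _        = [-]
  Linked-++⁻ˡ (x ∷ y ∷ xs) (r ∷ lk) = r ∷ Linked-++⁻ˡ (y ∷ xs) lk

  Linked-++⁻ʳ : ∀ xs {ys} → Linked R (xs ++ ys) → Linked R ys
  Linked-++⁻ʳ []       lk = lk
  Linked-++⁻ʳ (x ∷ xs) lk = Linked-++⁻ʳ xs (Linked.tail lk)

  Linked-++-middle : ∀ xs {a b ys} → Linked R (xs ++ a ∷ b ∷ ys) → R a b
  Linked-++-middle []       lk = Linked.head lk
  Linked-++-middle (x ∷ xs) lk = Linked-++-middle xs (Linked.tail lk)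

  Linked-++-replace : ∀ xs {y y′ ys} → Linked R (xs ++ y ∷ ys) → (∀ {x} → R x y → R x y′) →
    Linked R (y′ ∷ ys) → Linked R (xs ++ y′ ∷ ys)
  Linked-++-replace []            _        _   lk′ = lk′
  Linked-++-replace (x ∷ [])      (r ∷ _)  fix lk′ = fix r ∷ lk′
  Linked-++-replace (x ∷ x′ ∷ xs) (r ∷ lk) fix lk′ = r ∷ Linked-++-replace (x′ ∷ xs) lk fix lk′

  AllPairs-++-before : ∀ xs {y ys} → AllPairs R (xs ++ y ∷ ys) → All (λ x → R x y) xs
  AllPairs-++-before []       _         = []
  AllPairs-++-before (x ∷ xs) (Rx ∷ ap) = All.head (All.++⁻ʳ xs Rx) ∷ AllPairs-++-before xs ap

All-++-replace : ∀ {A : Set} {P : A → Set} xs {y y′ ys} →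
  All P (xs ++ y ∷ ys) → P y′ → All P (xs ++ y′ ∷ ys)
All-++-replace xs pxs py′ = All.++⁺ (All.++⁻ˡ xs pxs) (py′ ∷ All.tail (All.++⁻ʳ xs pxs))

module _ {A B : Set} {f : A → B} where

  Unique-map⁺-on : ∀ {xs} → (∀ {x y} → x ∈ xs → y ∈ xs → f x ≡ f y → x ≡ y) →
    Unique xs → Unique (map f xs)
  Unique-map⁺-on {[]}     _   _             = []
  Unique-map⁺-on {x ∷ xs} inj (x∉xs ∷ uniq) =
    All.map⁺ (All.tabulate λ y∈ fx≡fy → All.lookup x∉xs y∈ (inj (here refl) (there y∈) fx≡fy))
    ∷ Unique-map⁺-on (λ x∈ y∈ → inj (there x∈) (there y∈)) uniq

module _ {A B : Set} (f : A → List B) where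

  Unique-concatMap⁺ : ∀ {xs} → Unique xs → (∀ {x} → x ∈ xs → Unique (f x)) →
    (∀ {x x′ y} → x ∈ xs → x′ ∈ xs → y ∈ f x → y ∈ f x′ → x ≡ x′) → Unique (concatMap f xs)
  Unique-concatMap⁺ {[]}     _             _     _        = []
  Unique-concatMap⁺ {x ∷ xs} (x∉xs ∷ uniq) uniqF separate =
    Unique.++⁺ (uniqF (here refl))
               (Unique-concatMap⁺ uniq (uniqF ∘ there) (λ x∈ x′∈ → separate (there x∈) (there x′∈)))
               λ (y∈fx , y∈rest) → let x′ , x′∈xs , y∈fx′ = find (∈-concatMap⁻ f y∈rest)
                                   in All.lookup x∉xs x′∈xs (separate (here refl) (there x′∈xs) y∈fx y∈fx′)

  length-concatMap-const : ∀ m xs → (∀ {x} → x ∈ xs → length (f x) ≡ m) →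
    length (concatMap f xs) ≡ length xs * m
  length-concatMap-const m []       _   = refl
  length-concatMap-const m (x ∷ xs) len =
    trans (length-++ (f x)) (cong₂ _+_ (len (here refl)) (length-concatMap-const m xs (len ∘ there)))

-- Transposition

_≥ᴸ_ : List ℕ → List ℕ → Set
r ≥ᴸ s = length s ≤ length r

-- Its implicit lists cannot be inferred from their lengths, so uses eta-expand it.
≥ᴸ-trans : Transitive _≥ᴸ_
≥ᴸ-trans r≥s s≥t = ≤-trans s≥t r≥s

NonIncreasingLengths : List (List ℕ) → Set
NonIncreasingLengths = Linked _≥ᴸ_

slice : List (List ℕ) → ℕ → List ℕ
slice X i = mapMaybe (λ x → at x i) X

prependColumn : List ℕ → List (List ℕ) → List (List ℕ)
prependColumn []       R       = R
prependColumn (x ∷ xs) []      = (x ∷ []) ∷ prependColumn xs []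
prependColumn (x ∷ xs) (r ∷ R) = (x ∷ r) ∷ prependColumn xs R

transpose : List (List ℕ) → List (List ℕ)
transpose []      = []
transpose (c ∷ C) = prependColumn c (transpose C)

maxLen-tail : ∀ c C → NonIncreasingLengths (c ∷ C) → maxLen C ≤ length c
maxLen-tail c []      _          = z≤n
maxLen-tail c (d ∷ C) (d≤c ∷ ni) = ⊔-lub d≤c (≤-trans (maxLen-tail d C ni) d≤c)

slice-beyond : ∀ C i → maxLen C ≤ i → slice C i ≡ []
slice-beyond []      i _ = refl
slice-beyond (c ∷ C) i max≤i
  rewrite at-beyond c (≤-trans (m≤m⊔n (length c) (maxLen C)) max≤i) =
  slice-beyond C i (≤-trans (m≤n⊔m (length c) (maxLen C)) max≤i)

-- maybe′ _∷_ id (at c i) is the head that slice (c ∷ C) i unfolds to.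
applyUpTo-prependColumn : ∀ c (g : ℕ → List ℕ) m → m ≤ length c → (∀ i → m ≤ i → g i ≡ []) →
  applyUpTo (λ i → maybe′ _∷_ id (at c i) (g i)) (length c) ≡ prependColumn c (applyUpTo g m)
applyUpTo-prependColumn []      g zero    _           _      = refl
applyUpTo-prependColumn (x ∷ c) g zero    _           g≡[] =
  cong₂ _∷_ (cong (x ∷_) (g≡[] 0 z≤n))
            (applyUpTo-prependColumn c (g ∘ suc) zero z≤n (λ i _ → g≡[] (suc i) z≤n))
applyUpTo-prependColumn (x ∷ c) g (suc m) (s≤s m≤c) g≡[] =
  cong ((x ∷ g 0) ∷_) (applyUpTo-prependColumn c (g ∘ suc) m m≤c (λ i m≤i → g≡[] (suc i) (s≤s m≤i)))

applyUpTo-slice : ∀ C → NonIncreasingLengths C → applyUpTo (slice C) (maxLen C) ≡ transpose C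
applyUpTo-slice []      _  = refl
applyUpTo-slice (c ∷ C) ni = begin
  applyUpTo (slice (c ∷ C)) (length c ⊔ maxLen C)
    ≡⟨ cong (applyUpTo (slice (c ∷ C))) (m≥n⇒m⊔n≡m C≤c) ⟩
  applyUpTo (slice (c ∷ C)) (length c)
    ≡⟨ applyUpTo-prependColumn c (slice C) (maxLen C) C≤c (slice-beyond C) ⟩
  prependColumn c (applyUpTo (slice C) (maxLen C))
    ≡⟨ cong (prependColumn c) (applyUpTo-slice C (Linked.tail ni)) ⟩
  prependColumn c (transpose C) ∎
  where
  open ≡-Reasoning
  C≤c : maxLen C ≤ length c
  C≤c = maxLen-tail c C ni

rowsFromColumns≡transpose : ∀ C → NonIncreasingLengths C → rowsFromColumns C ≡ transpose C
rowsFromColumns≡transpose C ni = trans (map-upTo (slice C) (maxLen C)) (applyUpTo-slice C ni)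

length-prependColumn : ∀ c R → length (prependColumn c R) ≡ length c ⊔ length R
length-prependColumn []      R       = refl
length-prependColumn (x ∷ c) []      = cong suc (trans (length-prependColumn c []) (⊔-identityʳ (length c)))
length-prependColumn (x ∷ c) (r ∷ R) = cong suc (length-prependColumn c R)

length-transpose : ∀ C → length (transpose C) ≡ maxLen C
length-transpose []      = refl
length-transpose (c ∷ C) =
  trans (length-prependColumn c (transpose C)) (cong (length c ⊔_) (length-transpose C))

prependColumn-nonEmpty : ∀ c R → All NonEmpty R → All NonEmpty (prependColumn c R)
prependColumn-nonEmpty []      R       ne       = ne
prependColumn-nonEmpty (x ∷ c) []      _        = nonEmpty ∷ prependColumn-nonEmpty c [] []
prependColumn-nonEmpty (x ∷ c) (r ∷ R) (_ ∷ ne) = nonEmpty ∷ prependColumn-nonEmpty c R ne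

transpose-nonEmpty : ∀ C → All NonEmpty (transpose C)
transpose-nonEmpty []      = []
transpose-nonEmpty (c ∷ C) = prependColumn-nonEmpty c (transpose C) (transpose-nonEmpty C)

prependColumn-All : ∀ {P : ℕ → Set} c R → All P c → All (All P) R → All (All P) (prependColumn c R)
prependColumn-All []      R       _          pR        = pR
prependColumn-All (x ∷ c) []      (px ∷ pc)  _         = (px ∷ []) ∷ prependColumn-All c [] pc []
prependColumn-All (x ∷ c) (r ∷ R) (px ∷ pc)  (pr ∷ pR) = (px ∷ pr) ∷ prependColumn-All c R pc pR

transpose-All : ∀ {P : ℕ → Set} C → All (All P) C → All (All P) (transpose C)
transpose-All []      _         = []
transpose-All (c ∷ C) (pc ∷ pC) = prependColumn-All c (transpose C) pc (transpose-All C pC)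

-- Adding a cell

appendTo : List (List ℕ) → ℕ → ℕ → List (List ℕ)
appendTo []      k       N = (N ∷ []) ∷ []
appendTo (b ∷ A) zero    N = (b ∷ʳ N) ∷ A
appendTo (b ∷ A) (suc k) N = b ∷ appendTo A k N

EntriesBelow : ℕ → List (List ℕ) → Set
EntriesBelow N = All (All (_< N))

concat-appendTo-↭ : ∀ A k N → concat (appendTo A k N) ↭ N ∷ concat A
concat-appendTo-↭ []      k       N = ↭-refl
concat-appendTo-↭ (b ∷ A) zero    N = ↭-trans (↭-reflexive (++-assoc b (N ∷ []) (concat A))) (shift N b (concat A))
concat-appendTo-↭ (b ∷ A) (suc k) N = ↭-trans (++⁺ˡ b (concat-appendTo-↭ A k N)) (shift N b (concat A))

entry-appendTo : ∀ X k N i j {v} → entry X i j ≡ just v → entry (appendTo X k N) i j ≡ just v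
entry-appendTo (b ∷ X) zero    N zero    j eq with at-∷ʳ b N j
... | inj₁ same                = trans same eq
... | inj₂ (_ , atNothing) with () ← trans (sym eq) atNothing
entry-appendTo (b ∷ X) zero    N (suc i) j eq = eq
entry-appendTo (b ∷ X) (suc k) N zero    j eq = eq
entry-appendTo (b ∷ X) (suc k) N (suc i) j eq = entry-appendTo X k N i j eq

-- Placed N X j Z: Z is X with N added as a new cell in column j, i.e. appended
-- to the first row of length j (as a new last row if there is none and j = 0).
data Placed (N : ℕ) : List (List ℕ) → ℕ → List (List ℕ) → Set where
  new   : Placed N [] 0 ((N ∷ []) ∷ [])
  here  : ∀ {x X j} → length x ≡ j → Placed N (x ∷ X) j ((x ∷ʳ N) ∷ X)
  there : ∀ {x X j Z} → length x ≢ j → Placed N X j Z → Placed N (x ∷ X) j (x ∷ Z)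

Placed⇒appendTo : ∀ {N X j Z} → Placed N X j Z →
  ∃[ i ] (Z ≡ appendTo X i N × rowLen X i ≡ j × i ≤ length X)
Placed⇒appendTo new          = 0 , refl , refl , z≤n
Placed⇒appendTo (here len≡j) = 0 , refl , len≡j , z≤n
Placed⇒appendTo (there _ P) with i , refl , len≡j , i≤ ← Placed⇒appendTo P = suc i , refl , len≡j , s≤s i≤

private
  ∷ʳ≢[] : ∀ (xs : List ℕ) y → xs ∷ʳ y ≢ []
  ∷ʳ≢[] []       y ()
  ∷ʳ≢[] (x ∷ xs) y ()

  notBelow-self : ∀ {N} {xs : List ℕ} → All (_< N) (N ∷ xs) → ⊥
  notBelow-self (N<N ∷ _) = <-irrefl refl N<N

  notBelow-last : ∀ {N} (xs : List ℕ) → All (_< N) (xs ∷ʳ N) → ⊥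
  notBelow-last xs below = notBelow-self (All.++⁻ʳ xs below)

appendTo-injective : ∀ {N} A B k l → appendTo A k N ≡ appendTo B l N →
  All NonEmpty A → All NonEmpty B → EntriesBelow N A → EntriesBelow N B →
  k ≤ length A → l ≤ length B → A ≡ B × k ≡ l
appendTo-injective []      []      zero    zero    _  _ _ _ _ _ _ = refl , refl
appendTo-injective []      (b ∷ B) zero    zero    eq _ (nonEmpty {xs = b′} ∷ _) _ _ _ _ =
  ⊥-elim (∷ʳ≢[] b′ _ (sym (proj₂ (∷-injective (proj₁ (∷-injective eq))))))
appendTo-injective []      (b ∷ B) zero    (suc l) eq _ _ _ (below ∷ _) _ _
  with refl ← proj₁ (∷-injective eq) = ⊥-elim (notBelow-self below)
appendTo-injective (a ∷ A) []      zero    zero    eq (nonEmpty {xs = a′} ∷ _) _ _ _ _ _ =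
  ⊥-elim (∷ʳ≢[] a′ _ (proj₂ (∷-injective (proj₁ (∷-injective eq)))))
appendTo-injective (a ∷ A) []      (suc k) zero    eq _ _ (below ∷ _) _ _ _
  with refl ← proj₁ (∷-injective eq) = ⊥-elim (notBelow-self below)
appendTo-injective (a ∷ A) (b ∷ B) zero    zero    eq _ _ _ _ _ _
  with refl , refl ← ∷-injective eq | refl ← ∷ʳ-injectiveˡ a b (proj₁ (∷-injective eq)) = refl , refl
appendTo-injective (a ∷ A) (b ∷ B) zero    (suc l) eq _ _ _ (below ∷ _) _ _
  with refl ← proj₁ (∷-injective eq) = ⊥-elim (notBelow-last a below)
appendTo-injective (a ∷ A) (b ∷ B) (suc k) zero    eq _ _ (below ∷ _) _ _ _
  with refl ← proj₁ (∷-injective eq) = ⊥-elim (notBelow-last b below)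
appendTo-injective (a ∷ A) (b ∷ B) (suc k) (suc l) eq
                   (_ ∷ neA) (_ ∷ neB) (_ ∷ bA) (_ ∷ bB) (s≤s k≤) (s≤s l≤)
  with refl , eq′ ← ∷-injective eq
  with refl , refl ← appendTo-injective A B k l eq′ neA neB bA bB k≤ l≤ = refl , refl

Placed-injective : ∀ {N X Y j k Z Z′} → Placed N X j Z → Placed N Y k Z′ → Z ≡ Z′ →
  All NonEmpty X → All NonEmpty Y → EntriesBelow N X → EntriesBelow N Y → X ≡ Y × j ≡ k
Placed-injective {X = X} {Y} P Q eq neX neY bX bY
  with i , refl , refl , i≤ ← Placed⇒appendTo P | i′ , refl , refl , i′≤ ← Placed⇒appendTo Q
  with refl , refl ← appendTo-injective X Y i i′ eq neX neY bX bY i≤ i′≤ = refl , refl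

Placed-functional : ∀ {N X j Z Z′} → Placed N X j Z → Placed N X j Z′ → Z ≡ Z′
Placed-functional new             new               = refl
Placed-functional (here _)        (here _)          = refl
Placed-functional (here len≡j)    (there len≢j _)   = contradiction len≡j len≢j
Placed-functional (there len≢j _) (here len≡j)      = contradiction len≡j len≢j
Placed-functional (there _ P)     (there _ P′)      = cong (_ ∷_) (Placed-functional P P′)

Placed-++ : ∀ {N X j Z} U → All (λ u → length u ≢ j) U → Placed N X j Z → Placed N (U ++ X) j (U ++ Z)
Placed-++ []      _           P = P
Placed-++ (u ∷ U) (u≢j ∷ U≢j) P = there u≢j (Placed-++ U U≢j P)

Placed-newRow : ∀ {N} U → All (λ u → length u ≢ 0) U → Placed N U 0 (U ++ (N ∷ []) ∷ [])
Placed-newRow []      _           = new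
Placed-newRow (u ∷ U) (u≢0 ∷ U≢0) = there u≢0 (Placed-newRow U U≢0)

supp-Placed : ∀ {N X j Z} → Placed N X j Z → supp Z ↭ N ∷ supp X
supp-Placed {N} {X} P with i , refl , _ ← Placed⇒appendTo P = concat-appendTo-↭ X i N

opaque
  δ : ℕ → ℕ → ℕ
  δ m n with m ≟ n
  ... | yes _ = 1
  ... | no _  = 0

  δ-≡ : ∀ {m n} → m ≡ n → δ m n ≡ 1
  δ-≡ {m} {n} m≡n with m ≟ n
  ... | yes _   = refl
  ... | no m≢n  = contradiction m≡n m≢n

  δ-≢ : ∀ {m n} → m ≢ n → δ m n ≡ 0
  δ-≢ {m} {n} m≢n with m ≟ n
  ... | yes m≡n = contradiction m≡n m≢n
  ... | no _    = refl

countLength : List (List ℕ) → ℕ → ℕ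
countLength []      l = 0
countLength (r ∷ R) l = δ (length r) l + countLength R l

countLength-zero : ∀ X → All NonEmpty X → countLength X 0 ≡ 0
countLength-zero []            _        = refl
countLength-zero ((x ∷ r) ∷ X) (_ ∷ ne) = trans (cong (_+ countLength X 0) (δ-≢ λ ())) (countLength-zero X ne)

-- Only for positive lengths: a new singleton block does not come from a block of length 0.
countLength-appendTo : ∀ A k N l →
  countLength (appendTo A k N) (suc l) + δ (rowLen A k) (suc l) ≡ countLength A (suc l) + δ (suc (rowLen A k)) (suc l)
countLength-appendTo []      k       N l rewrite δ-≢ {0} {suc l} (λ ()) = trans (+-identityʳ _) (+-identityʳ _)
countLength-appendTo (b ∷ A) zero    N l rewrite length-∷ʳ b N =
  +-outer-swap (δ (suc (length b)) (suc l)) (countLength A (suc l)) (δ (length b) (suc l))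
  where
  +-outer-swap : ∀ p q r → p + q + r ≡ r + q + p
  +-outer-swap = solve-∀
countLength-appendTo (b ∷ A) (suc k) N l = begin
  δ (length b) (suc l) + countLength (appendTo A k N) (suc l) + δ (rowLen A k) (suc l)
    ≡⟨ +-assoc (δ (length b) (suc l)) _ _ ⟩
  δ (length b) (suc l) + (countLength (appendTo A k N) (suc l) + δ (rowLen A k) (suc l))
    ≡⟨ cong (δ (length b) (suc l) +_) (countLength-appendTo A k N l) ⟩
  δ (length b) (suc l) + (countLength A (suc l) + δ (suc (rowLen A k)) (suc l))
    ≡⟨ +-assoc (δ (length b) (suc l)) _ _ ⟨
  δ (length b) (suc l) + countLength A (suc l) + δ (suc (rowLen A k)) (suc l) ∎
  where open ≡-Reasoning

Placed-prependColumn-zero : ∀ N c R → length R ≤ length c → All NonEmpty R →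
  Placed N (prependColumn c R) 0 (prependColumn (c ∷ʳ N) R)
Placed-prependColumn-zero N []      []      _         _        = new
Placed-prependColumn-zero N (x ∷ c) []      _         _        =
  there (λ ()) (Placed-prependColumn-zero N c [] z≤n [])
Placed-prependColumn-zero N (x ∷ c) (r ∷ R) (s≤s R≤c) (_ ∷ ne) =
  there (λ ()) (Placed-prependColumn-zero N c R R≤c ne)

Placed-prependColumn-suc : ∀ {N R j R′} c → Placed N R j R′ → length R′ ≤ length c →
  Placed N (prependColumn c R) (suc j) (prependColumn c R′)
Placed-prependColumn-suc (x ∷ c) new             _          = here refl
Placed-prependColumn-suc (x ∷ c) (here len≡j)    _          = here (cong suc len≡j)
Placed-prependColumn-suc (x ∷ c) (there len≢j P) (s≤s R′≤c) =
  there (len≢j ∘ suc-injective) (Placed-prependColumn-suc c P R′≤c)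

length-transpose-tail : ∀ c C → NonIncreasingLengths (c ∷ C) → length (transpose C) ≤ length c
length-transpose-tail c C ni = subst (_≤ length c) (sym (length-transpose C)) (maxLen-tail c C ni)

transpose-appendTo : ∀ N C j → NonIncreasingLengths C → NonIncreasingLengths (appendTo C j N) →
  j ≤ length C → Placed N (transpose C) j (transpose (appendTo C j N))
transpose-appendTo N []      zero    _  _   _         = new
transpose-appendTo N (c ∷ C) zero    ni _   _         =
  Placed-prependColumn-zero N c (transpose C) (length-transpose-tail c C ni) (transpose-nonEmpty C)
transpose-appendTo N (c ∷ C) (suc j) ni ni′ (s≤s j≤C) =
  Placed-prependColumn-suc c (transpose-appendTo N C j (Linked.tail ni) (Linked.tail ni′) j≤C)
                             (length-transpose-tail c (appendTo C j N) ni′)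

-- The product c(T)

private
  <⇒<ᵇ≡true : ∀ {m n} → m < n → (m <ᵇ n) ≡ true
  <⇒<ᵇ≡true {m} {n} m<n with m <ᵇ n | <⇒<ᵇ m<n
  ... | true | _ = refl

  ≤⇒>ᵇ≡false : ∀ {m n} → m ≤ n → (n <ᵇ m) ≡ false
  ≤⇒>ᵇ≡false {m} {n} m≤n with n <ᵇ m in eq
  ... | false = refl
  ... | true  = contradiction m≤n (<⇒≱ (<ᵇ⇒< n m (subst T (sym eq) tt)))

-- cRow r X o is the product of the factors c_{ij} over the cells of the row r,
-- whose first cell lies in column o and which is the first row of X.
cRow : List ℕ → List (List ℕ) → ℕ → ℕ
cRow []           X o = 1
cRow (x ∷ [])     X o = 1
cRow (x ∷ y ∷ ys) X o = countBelow X o y * cRow (y ∷ ys) X (suc o)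

product-cij≡cRow : ∀ r X o →
  product (applyUpTo (λ j → maybe (λ x → countBelow X (o + j) x) 0 (at r (suc j))) (length r ∸ 1)) ≡ cRow r X o
product-cij≡cRow []           X o = refl
product-cij≡cRow (x ∷ [])     X o = refl
product-cij≡cRow (x ∷ y ∷ ys) X o = cong₂ _*_
  (cong (λ o′ → countBelow X o′ y) (+-identityʳ o))
  (trans (cong product (applyUpTo-cong (length ys) λ j →
            cong (λ o′ → maybe (λ x → countBelow X o′ x) 0 (at (y ∷ ys) (suc j))) (+-suc o j)))
         (product-cij≡cRow (y ∷ ys) X (suc o)))

c-∷ : ∀ r R → c (r ∷ R) ≡ cRow r (r ∷ R) 0 * c R
c-∷ r R = cong₂ _*_
  (trans (cong product (map-upTo _ (length r ∸ 1))) (product-cij≡cRow r (r ∷ R) 0))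
  (trans (cong product (map-applyUpTo suc _ (length R))) (cong product (sym (map-upTo _ (length R)))))

countBelow-appendTo : ∀ X i N o {y} → y ≤ N → countBelow (appendTo X i N) o y ≡ countBelow X o y
countBelow-appendTo []      i       N zero    y≤N rewrite ≤⇒>ᵇ≡false y≤N = refl
countBelow-appendTo []      i       N (suc o) _   = refl
countBelow-appendTo (b ∷ X) zero    N o       y≤N with at-∷ʳ b N o
... | inj₁ same                 rewrite same = refl
... | inj₂ (atN , atNothing) rewrite atN | atNothing | ≤⇒>ᵇ≡false y≤N = refl
countBelow-appendTo (b ∷ X) (suc i) N o       y≤N rewrite countBelow-appendTo X i N o y≤N = refl

cRow-cong : ∀ {X Y N} → (∀ o {y} → y ≤ N → countBelow X o y ≡ countBelow Y o y) →
  ∀ r → All (_≤ N) r → ∀ o → cRow r X o ≡ cRow r Y o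
cRow-cong same []           _               o = refl
cRow-cong same (x ∷ [])     _               o = refl
cRow-cong same (x ∷ y ∷ ys) (_ ∷ y≤N ∷ ys≤N) o =
  cong₂ _*_ (same o y≤N) (cRow-cong same (y ∷ ys) (y≤N ∷ ys≤N) (suc o))

cRow-∷ʳ : ∀ a x N X o → cRow ((a ∷ x) ∷ʳ N) X o ≡ cRow (a ∷ x) X o * countBelow X (o + length x) N
cRow-∷ʳ a []      N X o rewrite +-identityʳ o = trans (*-identityʳ _) (sym (*-identityˡ _))
cRow-∷ʳ a (b ∷ x) N X o = begin
  countBelow X o b * cRow ((b ∷ x) ∷ʳ N) X (suc o)
    ≡⟨ cong (countBelow X o b *_) (cRow-∷ʳ b x N X (suc o)) ⟩
  countBelow X o b * (cRow (b ∷ x) X (suc o) * countBelow X (suc o + length x) N)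
    ≡⟨ *-assoc (countBelow X o b) _ _ ⟨
  countBelow X o b * cRow (b ∷ x) X (suc o) * countBelow X (suc o + length x) N
    ≡⟨ cong (λ o′ → countBelow X o b * cRow (b ∷ x) X (suc o) * countBelow X o′ N) (+-suc o (length x)) ⟨
  countBelow X o b * cRow (b ∷ x) X (suc o) * countBelow X (o + suc (length x)) N ∎
  where open ≡-Reasoning

countBelow-shortRows : ∀ {N} j X → All (λ r → length r ≤ suc j) X → EntriesBelow N X →
  countBelow X j N ≡ countLength X (suc j)
countBelow-shortRows j []      _               _             = refl
countBelow-shortRows j (r ∷ X) (r≤ ∷ short) (r<N ∷ below) with at r j in atj
... | just v rewrite <⇒<ᵇ≡true (All-at r j r<N atj) =
  trans (cong suc (countBelow-shortRows j X short below))
        (cong (_+ countLength X (suc j)) (sym (δ-≡ (≤-antisym r≤ (at-just⇒< r j atj)))))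
... | nothing =
  trans (countBelow-shortRows j X short below)
        (cong (_+ countLength X (suc j)) (sym (δ-≢ λ r≡ → ends-before (subst (j <_) (sym r≡) ≤-refl))))
  where
  ends-before : j < length r → ⊥
  ends-before j<r with v , atj′ ← <⇒at-just r j j<r with () ← trans (sym atj) atj′

ShortBelow : ∀ {N X j Z} → Placed N X j Z → Set
ShortBelow new                  = ⊤
ShortBelow (here {X = X} {j} _) = All (λ r → length r ≤ j) X
ShortBelow (there _ P)          = ShortBelow P

ShortBelow-++ : ∀ {N X j Z} U (U≢j : All (λ u → length u ≢ j) U) (P : Placed N X j Z) →
  ShortBelow P → ShortBelow (Placed-++ U U≢j P)
ShortBelow-++ []      _           P short = short
ShortBelow-++ (u ∷ U) (_ ∷ U≢j)   P short = ShortBelow-++ U U≢j P short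

ShortBelow-newRow : ∀ {N} U (U≢0 : All (λ u → length u ≢ 0) U) → ShortBelow (Placed-newRow {N} U U≢0)
ShortBelow-newRow []      _         = tt
ShortBelow-newRow (u ∷ U) (_ ∷ U≢0) = ShortBelow-newRow U U≢0

-- Every old factor c_{ij} only counts entries smaller than its own, so cannot see N;
-- the new cell's factor counts its own row and the rows below of the same length.
c-Placed : ∀ {N X j Z} (P : Placed N X j Z) → ShortBelow P → All NonEmpty X → EntriesBelow N X →
  c Z ≡ c X * (countLength X j + δ 0 j)
c-Placed new _ _ _ = cong (λ d → 1 * (0 + d)) (sym (δ-≡ refl))
c-Placed {N} (here {x = a ∷ x} {X} refl) short (nonEmpty ∷ _) (x<N ∷ below) = begin
  c (xN ∷ X)
    ≡⟨ c-∷ xN X ⟩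
  cRow xN (xN ∷ X) 0 * c X
    ≡⟨ cong (_* c X) (cRow-∷ʳ a x N (xN ∷ X) 0) ⟩
  cRow (a ∷ x) (xN ∷ X) 0 * countBelow (xN ∷ X) (length x) N * c X
    ≡⟨ cong₂ (λ p q → p * q * c X) earlier-factors new-factor ⟩
  cRow (a ∷ x) ((a ∷ x) ∷ X) 0 * suc (countLength X j) * c X
    ≡⟨ rearrange (cRow (a ∷ x) ((a ∷ x) ∷ X) 0) (countLength X j) (c X) ⟩
  cRow (a ∷ x) ((a ∷ x) ∷ X) 0 * c X * (1 + countLength X j + 0)
    ≡⟨ cong₂ (λ p q → cRow (a ∷ x) ((a ∷ x) ∷ X) 0 * c X * (p + countLength X j + q))
             (δ-≡ refl) (δ-≢ (λ ())) ⟨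
  cRow (a ∷ x) ((a ∷ x) ∷ X) 0 * c X * (countLength ((a ∷ x) ∷ X) j + δ 0 j)
    ≡⟨ cong (_* (countLength ((a ∷ x) ∷ X) j + δ 0 j)) (c-∷ (a ∷ x) X) ⟨
  c ((a ∷ x) ∷ X) * (countLength ((a ∷ x) ∷ X) j + δ 0 j) ∎
  where
  open ≡-Reasoning
  xN : List ℕ
  xN = (a ∷ x) ∷ʳ N
  j : ℕ
  j = length (a ∷ x)
  earlier-factors : cRow (a ∷ x) (xN ∷ X) 0 ≡ cRow (a ∷ x) ((a ∷ x) ∷ X) 0
  earlier-factors = cRow-cong (λ o → countBelow-appendTo ((a ∷ x) ∷ X) 0 N o) (a ∷ x) (All.map <⇒≤ x<N) 0
  new-factor : countBelow (xN ∷ X) (length x) N ≡ suc (countLength X j)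
  new-factor with v , atLast ← <⇒at-just (a ∷ x) (length x) ≤-refl
    rewrite at-∷ʳ-≢length (a ∷ x) N (length x) (λ eq → <-irrefl eq ≤-refl) | atLast
          | <⇒<ᵇ≡true (All-at (a ∷ x) (length x) x<N atLast) =
    cong suc (countBelow-shortRows (length x) X short below)
  rearrange : ∀ p q r → p * suc q * r ≡ p * r * (1 + q + 0)
  rearrange = solve-∀
c-Placed (there {x} {X} {j} {Z} len≢j P) short (_ ∷ ne) (x<N ∷ below) = begin
  c (x ∷ Z)
    ≡⟨ c-∷ x Z ⟩
  cRow x (x ∷ Z) 0 * c Z
    ≡⟨ cong₂ _*_ earlier-factors (c-Placed P short ne below) ⟩
  cRow x (x ∷ X) 0 * (c X * m)
    ≡⟨ *-assoc (cRow x (x ∷ X) 0) (c X) m ⟨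
  cRow x (x ∷ X) 0 * c X * m
    ≡⟨ cong (λ d → cRow x (x ∷ X) 0 * c X * (d + countLength X j + δ 0 j)) (δ-≢ len≢j) ⟨
  cRow x (x ∷ X) 0 * c X * (countLength (x ∷ X) j + δ 0 j)
    ≡⟨ cong (_* (countLength (x ∷ X) j + δ 0 j)) (c-∷ x X) ⟨
  c (x ∷ X) * (countLength (x ∷ X) j + δ 0 j) ∎
  where
  open ≡-Reasoning
  m : ℕ
  m = countLength X j + δ 0 j
  earlier-factors : cRow x (x ∷ Z) 0 ≡ cRow x (x ∷ X) 0
  earlier-factors with i , refl , _ ← Placed⇒appendTo P =
    cRow-cong (λ o → countBelow-appendTo (x ∷ X) (suc i) _ o) x (All.map <⇒≤ x<N) 0

-- The tableau 𝒯(𝒜)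

insert-All : ∀ {P : ℕ → Set} x ys → P x → All P ys → All P (insert x ys)
insert-All x []       px _          = px ∷ []
insert-All x (y ∷ ys) px (py ∷ pys) with x <ᵇ y
... | true  = px ∷ py ∷ pys
... | false = py ∷ insert-All x ys px pys

sortℕ-All : ∀ {P : ℕ → Set} xs → All P xs → All P (sortℕ xs)
sortℕ-All []       _          = []
sortℕ-All (x ∷ xs) (px ∷ pxs) = insert-All x (sortℕ xs) px (sortℕ-All xs pxs)

length-insert : ∀ x ys → length (insert x ys) ≡ suc (length ys)
length-insert x []       = refl
length-insert x (y ∷ ys) with x <ᵇ y
... | true  = refl
... | false = cong suc (length-insert x ys)

length-sortℕ : ∀ xs → length (sortℕ xs) ≡ length xs
length-sortℕ []       = refl
length-sortℕ (x ∷ xs) = trans (length-insert x (sortℕ xs)) (cong suc (length-sortℕ xs))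

insert-max : ∀ N zs → All (_< N) zs → insert N zs ≡ zs ∷ʳ N
insert-max N []       _          = refl
insert-max N (z ∷ zs) (z<N ∷ zs<N) with N <ᵇ z in eq
... | true  = contradiction (<ᵇ⇒< N z (subst T (sym eq) tt)) (<⇒≯ z<N)
... | false = cong (z ∷_) (insert-max N zs zs<N)

insert-∷ʳ-max : ∀ N x zs → x < N → insert x (zs ∷ʳ N) ≡ insert x zs ∷ʳ N
insert-∷ʳ-max N x []       x<N with x <ᵇ N | <⇒<ᵇ x<N
... | true | _ = refl
insert-∷ʳ-max N x (z ∷ zs) x<N with x <ᵇ z
... | true  = refl
... | false = cong (z ∷_) (insert-∷ʳ-max N x zs x<N)

sortℕ-max : ∀ N xs ys → All (_< N) (xs ++ ys) → sortℕ (xs ++ N ∷ ys) ≡ sortℕ (xs ++ ys) ∷ʳ N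
sortℕ-max N []       ys below         = insert-max N (sortℕ ys) (sortℕ-All ys below)
sortℕ-max N (x ∷ xs) ys (x<N ∷ below) =
  trans (cong (insert x) (sortℕ-max N xs ys below)) (insert-∷ʳ-max N x (sortℕ (xs ++ ys)) x<N)

columns : List (List ℕ) → List (List ℕ)
columns A = map (sortedColumn A) (upTo (maxLen A))

length-slice-suc : ∀ A i → length (slice A (suc i)) ≤ length (slice A i)
length-slice-suc []      i = z≤n
length-slice-suc (r ∷ A) i with at r i in ati
... | nothing rewrite at-nothing-suc r i ati = length-slice-suc A i
... | just _ with at r (suc i)
...   | just _  = s≤s (length-slice-suc A i)
...   | nothing = m≤n⇒m≤1+n (length-slice-suc A i)

columns-nonIncreasing : ∀ A → NonIncreasingLengths (columns A)
columns-nonIncreasing A = subst NonIncreasingLengths (sym (map-upTo (sortedColumn A) (maxLen A)))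
  (Linked.applyUpTo⁺₂ (sortedColumn A) (maxLen A) λ i →
    subst₂ _≤_ (sym (length-sortℕ (slice A (suc i)))) (sym (length-sortℕ (slice A i))) (length-slice-suc A i))

𝒯≡transpose-columns : ∀ A → 𝒯 A ≡ transpose (columns A)
𝒯≡transpose-columns A = rowsFromColumns≡transpose (columns A) (columns-nonIncreasing A)

slice-All : ∀ {P : ℕ → Set} A j → All P (concat A) → All P (slice A j)
slice-All []      j _  = []
slice-All (b ∷ A) j pA with at b j in atj
... | just v  = All-at b j (All.++⁻ˡ b pA) atj ∷ slice-All A j (All.++⁻ʳ b pA)
... | nothing = slice-All A j (All.++⁻ʳ b pA)

𝒯-All : ∀ {P : ℕ → Set} A → All P (concat A) → All (All P) (𝒯 A)
𝒯-All A pA = subst (All (All _)) (sym (𝒯≡transpose-columns A))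
  (transpose-All (columns A) (All.map⁺ (All.applyUpTo⁺₂ id (maxLen A) λ i → sortℕ-All _ (slice-All A i pA))))

slice-appendTo-≢ : ∀ A k N j → j ≢ rowLen A k → slice (appendTo A k N) j ≡ slice A j
slice-appendTo-≢ []      k       N zero    0≢0 = contradiction refl 0≢0
slice-appendTo-≢ []      k       N (suc j) _   = refl
slice-appendTo-≢ (b ∷ A) zero    N j       j≢b =
  cong (λ v → maybe′ _∷_ id v (slice A j)) (at-∷ʳ-≢length b N j j≢b)
slice-appendTo-≢ (b ∷ A) (suc k) N j       j≢k = cong (maybe′ _∷_ id (at b j)) (slice-appendTo-≢ A k N j j≢k)

slice-appendTo-≡ : ∀ A k N → ∃[ xs ] ∃[ ys ]
  (slice (appendTo A k N) (rowLen A k) ≡ xs ++ N ∷ ys × slice A (rowLen A k) ≡ xs ++ ys)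
slice-appendTo-≡ []      k       N = [] , [] , refl , refl
slice-appendTo-≡ (b ∷ A) zero    N rewrite at-∷ʳ-length b N | at-beyond b ≤-refl = [] , _ , refl , refl
slice-appendTo-≡ (b ∷ A) (suc k) N with xs , ys , eq , eq′ ← slice-appendTo-≡ A k N with at b (rowLen A k)
... | just v  = v ∷ xs , ys , cong (v ∷_) eq , cong (v ∷_) eq′
... | nothing = xs , ys , eq , eq′

sortedColumn-appendTo-≢ : ∀ A k N j → j ≢ rowLen A k → sortedColumn (appendTo A k N) j ≡ sortedColumn A j
sortedColumn-appendTo-≢ A k N j j≢k = cong sortℕ (slice-appendTo-≢ A k N j j≢k)

sortedColumn-appendTo-≡ : ∀ A k N → All (_< N) (concat A) →
  sortedColumn (appendTo A k N) (rowLen A k) ≡ sortedColumn A (rowLen A k) ∷ʳ N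
sortedColumn-appendTo-≡ A k N below with xs , ys , eq , eq′ ← slice-appendTo-≡ A k N = begin
  sortℕ (slice (appendTo A k N) (rowLen A k)) ≡⟨ cong sortℕ eq ⟩
  sortℕ (xs ++ N ∷ ys)                         ≡⟨ sortℕ-max N xs ys (subst (All (_< N)) eq′ (slice-All A (rowLen A k) below)) ⟩
  sortℕ (xs ++ ys) ∷ʳ N                        ≡⟨ cong (λ zs → sortℕ zs ∷ʳ N) eq′ ⟨
  sortℕ (slice A (rowLen A k)) ∷ʳ N ∎
  where open ≡-Reasoning

maxLen-appendTo : ∀ A k N → maxLen (appendTo A k N) ≡ maxLen A ⊔ suc (rowLen A k)
maxLen-appendTo []      k       N = refl
maxLen-appendTo (b ∷ A) zero    N rewrite length-∷ʳ b N = begin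
  suc (length b) ⊔ maxLen A               ≡⟨ ⊔-comm (suc (length b)) (maxLen A) ⟩
  maxLen A ⊔ suc (length b)               ≡⟨ cong (maxLen A ⊔_) (m≤n⇒m⊔n≡n (n≤1+n (length b))) ⟨
  maxLen A ⊔ (length b ⊔ suc (length b))  ≡⟨ ⊔-assoc (maxLen A) (length b) _ ⟨
  maxLen A ⊔ length b ⊔ suc (length b)    ≡⟨ cong (_⊔ suc (length b)) (⊔-comm (maxLen A) (length b)) ⟩
  length b ⊔ maxLen A ⊔ suc (length b)    ∎
  where open ≡-Reasoning
maxLen-appendTo (b ∷ A) (suc k) N =
  trans (cong (length b ⊔_) (maxLen-appendTo A k N)) (sym (⊔-assoc (length b) (maxLen A) _))

rowLen≤maxLen : ∀ A k → rowLen A k ≤ maxLen A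
rowLen≤maxLen []      k       = z≤n
rowLen≤maxLen (b ∷ A) zero    = m≤m⊔n (length b) (maxLen A)
rowLen≤maxLen (b ∷ A) (suc k) = ≤-trans (rowLen≤maxLen A k) (m≤n⊔m (length b) (maxLen A))

applyUpTo-appendTo-< : ∀ N n (f g : ℕ → List ℕ) j → j < n → (∀ i → i ≢ j → g i ≡ f i) → g j ≡ f j ∷ʳ N →
  applyUpTo g n ≡ appendTo (applyUpTo f n) j N
applyUpTo-appendTo-< N (suc n) f g zero    _         g≗f gj =
  cong₂ _∷_ gj (applyUpTo-cong n λ i → g≗f (suc i) λ ())
applyUpTo-appendTo-< N (suc n) f g (suc j) (s≤s j<n) g≗f gj =
  cong₂ _∷_ (g≗f 0 λ ())
    (applyUpTo-appendTo-< N n (f ∘ suc) (g ∘ suc) j j<n (λ i i≢j → g≗f (suc i) (i≢j ∘ suc-injective)) gj)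

applyUpTo-appendTo-≡ : ∀ N n (f g : ℕ → List ℕ) → (∀ i → i < n → g i ≡ f i) → g n ≡ N ∷ [] →
  applyUpTo g (suc n) ≡ appendTo (applyUpTo f n) n N
applyUpTo-appendTo-≡ N zero    f g _   gn = cong (_∷ []) gn
applyUpTo-appendTo-≡ N (suc n) f g g≗f gn =
  cong₂ _∷_ (g≗f 0 (s≤s z≤n))
    (applyUpTo-appendTo-≡ N n (f ∘ suc) (g ∘ suc) (λ i i<n → g≗f (suc i) (s≤s i<n)) gn)

columns-appendTo : ∀ A k N → All (_< N) (concat A) → columns (appendTo A k N) ≡ appendTo (columns A) (rowLen A k) N
columns-appendTo A k N below = begin
  columns A′                                        ≡⟨ map-upTo g (maxLen A′) ⟩
  applyUpTo g (maxLen A′)                           ≡⟨ applyUpTo-columns ⟩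
  appendTo (applyUpTo f (maxLen A)) (rowLen A k) N  ≡⟨ cong (λ C → appendTo C (rowLen A k) N) (map-upTo f (maxLen A)) ⟨
  appendTo (columns A) (rowLen A k) N               ∎
  where
  open ≡-Reasoning
  A′ : List (List ℕ)
  A′ = appendTo A k N
  f g : ℕ → List ℕ
  f = sortedColumn A
  g = sortedColumn A′
  g≗f : ∀ i → i ≢ rowLen A k → g i ≡ f i
  g≗f = sortedColumn-appendTo-≢ A k N
  applyUpTo-columns : applyUpTo g (maxLen A′) ≡ appendTo (applyUpTo f (maxLen A)) (rowLen A k) N
  applyUpTo-columns rewrite maxLen-appendTo A k N with m≤n⇒m<n∨m≡n (rowLen≤maxLen A k)
  ... | inj₁ k<max rewrite m≥n⇒m⊔n≡m k<max =
    applyUpTo-appendTo-< N (maxLen A) f g (rowLen A k) k<max g≗f (sortedColumn-appendTo-≡ A k N below)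
  ... | inj₂ k≡max rewrite sym k≡max | m≤n⇒m⊔n≡n (n≤1+n (rowLen A k)) =
    applyUpTo-appendTo-≡ N (rowLen A k) f g (λ i i<k → g≗f i (<⇒≢ i<k)) new-column
    where
    new-column : g (rowLen A k) ≡ N ∷ []
    new-column = trans (sortedColumn-appendTo-≡ A k N below)
                       (cong (λ xs → sortℕ xs ∷ʳ N) (slice-beyond A (rowLen A k) (≤-reflexive (sym k≡max))))

𝒯-appendTo : ∀ A k N → All (_< N) (concat A) → Placed N (𝒯 A) (rowLen A k) (𝒯 (appendTo A k N))
𝒯-appendTo A k N below
  rewrite 𝒯≡transpose-columns A | 𝒯≡transpose-columns (appendTo A k N) | columns-appendTo A k N below =
  transpose-appendTo N (columns A) (rowLen A k) (columns-nonIncreasing A)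
    (subst NonIncreasingLengths (columns-appendTo A k N below) (columns-nonIncreasing (appendTo A k N)))
    (subst (rowLen A k ≤_) (sym (trans (length-map (sortedColumn A) (upTo (maxLen A))) (length-upTo (maxLen A))))
           (rowLen≤maxLen A k))

𝒯-nonEmpty : ∀ A → All NonEmpty (𝒯 A)
𝒯-nonEmpty A = subst (All NonEmpty) (sym (𝒯≡transpose-columns A)) (transpose-nonEmpty (columns A))

-- Set partitions

-- The blocks to which a new maximum can be appended so as to become a cell of
-- column j: the blocks of length j, and a new singleton block when j = 0.
slots : List (List ℕ) → ℕ → List ℕ
slots []      zero    = 0 ∷ []
slots []      (suc j) = []
slots (b ∷ A) j with length b ≟ j
... | yes _ = 0 ∷ map suc (slots A j)
... | no _  = map suc (slots A j)

length-slots : ∀ A j → length (slots A j) ≡ countLength A j + δ 0 j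
length-slots []      zero    = sym (δ-≡ refl)
length-slots []      (suc j) = sym (δ-≢ λ ())
length-slots (b ∷ A) j with length b ≟ j
... | yes b≡j = trans (cong suc (trans (length-map suc (slots A j)) (length-slots A j)))
                      (cong (λ d → d + countLength A j + δ 0 j) (sym (δ-≡ b≡j)))
... | no b≢j  = trans (trans (length-map suc (slots A j)) (length-slots A j))
                      (cong (λ d → d + countLength A j + δ 0 j) (sym (δ-≢ b≢j)))

∈-slots⁻ : ∀ A j {k} → k ∈ slots A j → rowLen A k ≡ j × k ≤ length A
∈-slots⁻ []      zero (here refl) = refl , z≤n
∈-slots⁻ (b ∷ A) j k∈ with length b ≟ j | k∈
... | yes b≡j | here refl = b≡j , z≤n
... | yes _   | there k∈′ with k , k∈″ , refl ← ∈-map⁻ suc k∈′ = map₂ s≤s (∈-slots⁻ A j k∈″)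
... | no _    | k∈′       with k , k∈″ , refl ← ∈-map⁻ suc k∈′ = map₂ s≤s (∈-slots⁻ A j k∈″)

∈-slots⁺ : ∀ A j k → rowLen A k ≡ j → k ≤ length A → k ∈ slots A j
∈-slots⁺ []      zero _     refl z≤n = here refl
∈-slots⁺ (b ∷ A) j    k     len≡j k≤ with length b ≟ j | k | k≤
... | yes _   | zero  | _       = here refl
... | yes _   | suc k | s≤s k≤′ = there (∈-map⁺ suc (∈-slots⁺ A j k len≡j k≤′))
... | no b≢j  | zero  | _       = contradiction len≡j b≢j
... | no _    | suc k | s≤s k≤′ = ∈-map⁺ suc (∈-slots⁺ A j k len≡j k≤′)

slots-unique : ∀ A j → Unique (slots A j)
slots-unique []      zero    = [] ∷ []
slots-unique []      (suc j) = []
slots-unique (b ∷ A) j with length b ≟ j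
... | yes _ = zero∉ (slots A j) ∷ Unique.map⁺ suc-injective (slots-unique A j)
  where
  zero∉ : ∀ ks → All (0 ≢_) (map suc ks)
  zero∉ []       = []
  zero∉ (k ∷ ks) = (λ ()) ∷ zero∉ ks
... | no _  = Unique.map⁺ suc-injective (slots-unique A j)

appendTo-nonEmpty : ∀ A k N → All NonEmpty A → All NonEmpty (appendTo A k N)
appendTo-nonEmpty []            k       N _         = nonEmpty ∷ []
appendTo-nonEmpty ((x ∷ b) ∷ A) zero    N (_ ∷ ne)  = nonEmpty ∷ ne
appendTo-nonEmpty (b ∷ A)       (suc k) N (nb ∷ ne) = nb ∷ appendTo-nonEmpty A k N ne

Linked-∷ʳ : ∀ {N} b → Linked _<_ b → All (_< N) b → Linked _<_ (b ∷ʳ N)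
Linked-∷ʳ []          _          _          = [-]
Linked-∷ʳ (x ∷ [])    _          (x<N ∷ _)  = x<N ∷ [-]
Linked-∷ʳ (x ∷ y ∷ b) (x<y ∷ lk) (_ ∷ below) = x<y ∷ Linked-∷ʳ (y ∷ b) lk below

appendTo-increasing : ∀ A k N → All (Linked _<_) A → EntriesBelow N A → All (Linked _<_) (appendTo A k N)
appendTo-increasing []      k       N _         _             = [-] ∷ []
appendTo-increasing (b ∷ A) zero    N (lb ∷ lA) (bb ∷ _)      = Linked-∷ʳ b lb bb ∷ lA
appendTo-increasing (b ∷ A) (suc k) N (lb ∷ lA) (_ ∷ below)   = lb ∷ appendTo-increasing A k N lA below

headLt-rightHead : ∀ a {y c c′} → headLt a (y ∷ c) → headLt a (y ∷ c′)
headLt-rightHead []      h = h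
headLt-rightHead (x ∷ a) h = h

Linked-headLt-firstHead : ∀ {x b b′} C → Linked headLt ((x ∷ b) ∷ C) → Linked headLt ((x ∷ b′) ∷ C)
Linked-headLt-firstHead []            _        = [-]
Linked-headLt-firstHead ([] ∷ C)      (h ∷ lk) = h ∷ lk
Linked-headLt-firstHead ((y ∷ c) ∷ C) (h ∷ lk) = h ∷ lk

appendTo-head : ∀ y c A k N → ∃[ c′ ] ∃[ A′ ] appendTo ((y ∷ c) ∷ A) k N ≡ (y ∷ c′) ∷ A′
appendTo-head y c A zero    N = c ∷ʳ N , A , refl
appendTo-head y c A (suc k) N = c , appendTo A k N , refl

appendTo-headLt : ∀ A k N → Linked headLt A → All NonEmpty A → EntriesBelow N A → Linked headLt (appendTo A k N)
appendTo-headLt []                  k       N _        _                    _             = [-]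
appendTo-headLt ((x ∷ b) ∷ A)       zero    N lk       _                    _             = Linked-headLt-firstHead A lk
appendTo-headLt ((x ∷ b) ∷ [])      (suc k) N _        _                    ((x<N ∷ _) ∷ _) = x<N ∷ [-]
appendTo-headLt (a ∷ [] ∷ A)        (suc k) N _        (_ ∷ () ∷ _)         _
appendTo-headLt (a ∷ (y ∷ c) ∷ A)   (suc k) N (h ∷ lk) (_ ∷ ne)             (_ ∷ below)
  with c′ , A′ , eq ← appendTo-head y c A k N
  with rest ← appendTo-headLt ((y ∷ c) ∷ A) k N lk ne below rewrite eq =
  headLt-rightHead a h ∷ rest

max-at-rowEnd : ∀ {N} X → All (Linked _<_) X → All (_≤ N) (concat X) → N ∈ concat X →
  ∃[ U ] ∃[ p ] ∃[ R ] X ≡ U ++ (p ∷ʳ N) ∷ R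
max-at-rowEnd {N} X incr ≤N N∈X
  with r , N∈r , r∈X ← ∈-concat⁻′ X N∈X
  with U , R , refl ← ∈-∃++ r∈X
  with p , q , refl ← ∈-∃++ N∈r
  with q
... | []    = U , p , R , refl
... | y ∷ q′ = ⊥-elim (<⇒≱ (Linked-++-middle p (All.head (All.++⁻ʳ U incr))) y≤N)
  where
  y≤N : y ≤ N
  y≤N with _ ∷ y≤N ∷ _ ← All.++⁻ʳ p (All.head (All.++⁻ʳ U (All.concat⁻ ≤N))) = y≤N

appendTo-length : ∀ U N → appendTo U (length U) N ≡ U ++ (N ∷ []) ∷ []
appendTo-length []      N = refl
appendTo-length (u ∷ U) N = cong (u ∷_) (appendTo-length U N)

appendTo-++ : ∀ U b R N → appendTo (U ++ b ∷ R) (length U) N ≡ U ++ (b ∷ʳ N) ∷ R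
appendTo-++ []      b R N = refl
appendTo-++ (u ∷ U) b R N = cong (u ∷_) (appendTo-++ U b R N)

record BlockRemoval (N : ℕ) (A : List (List ℕ)) : Set where
  field
    A′        : List (List ℕ)
    k         : ℕ
    appended  : A ≡ appendTo A′ k N
    k≤        : k ≤ length A′
    nonEmpty′ : All NonEmpty A′
    increasing′ : All (Linked _<_) A′
    headLt′   : Linked headLt A′

removeMax-block : ∀ {N} A → All NonEmpty A → All (Linked _<_) A → Linked headLt A →
  All (_≤ N) (concat A) → N ∈ concat A → BlockRemoval N A
removeMax-block {N} A ne incr hl ≤N N∈A with max-at-rowEnd A incr ≤N N∈A
... | U , [] , [] , refl = record
  { A′ = U ; k = length U ; appended = sym (appendTo-length U N) ; k≤ = ≤-refl
  ; nonEmpty′ = All.++⁻ˡ U ne ; increasing′ = All.++⁻ˡ U incr ; headLt′ = Linked-++⁻ˡ U hl }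
... | U , [] , [] ∷ R , refl with () ← All.head (All.tail (All.++⁻ʳ U ne))
... | U , [] , (y ∷ c) ∷ R , refl = ⊥-elim (<⇒≱ (Linked.head (Linked-++⁻ʳ U hl)) y≤N)
  where
  y≤N : y ≤ N
  y≤N with _ ∷ (y≤N ∷ _) ∷ _ ← All.++⁻ʳ U (All.concat⁻ ≤N) = y≤N
... | U , x ∷ p , R , refl = record
  { A′ = U ++ (x ∷ p) ∷ R ; k = length U ; appended = sym (appendTo-++ U (x ∷ p) R N)
  ; k≤ = subst (length U ≤_) (sym (length-++ U)) (m≤m+n (length U) _)
  ; nonEmpty′ = All-++-replace U ne nonEmpty
  ; increasing′ = All-++-replace U incr (Linked-++⁻ˡ (x ∷ p) (All.head (All.++⁻ʳ U incr)))
  ; headLt′ = Linked-++-replace U hl (λ {u} → headLt-rightHead u) (Linked-headLt-firstHead R (Linked-++⁻ʳ U hl)) }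

-- Removing the largest entry of a tableau

multilinear-Placed⁻ : ∀ {N X j Z} → Placed N X j Z → MultilinearTableau Z →
  IsShape X → All (Linked _<_) X → MultilinearTableau X
multilinear-Placed⁻ {N} {X} {Z = Z} P T shapeX rowsX = record
  { shape    = shapeX
  ; distinct = AllPairs.tail distinct′
  ; positive = All.tail (All-resp-↭ (supp-Placed P) positive)
  ; rowsIncr = rowsX
  ; colsIncr = λ i j x y x∈ y∈ → colsIncr i j x y (entryZ i j x∈) (entryZ (suc i) j y∈)
  }
  where
  open MultilinearTableau T
  distinct′ : Unique (N ∷ supp X)
  distinct′ = Unique-resp-↭ (supp-Placed P) distinct
  entryZ : ∀ i j {v} → entry X i j ≡ just v → entry Z i j ≡ just v
  entryZ i j with k , refl , _ ← Placed⇒appendTo P = entry-appendTo X k N i j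

entriesBelow-Placed : ∀ {N X j Z} → Placed N X j Z → MultilinearTableau Z →
  All (_≤ N) (supp Z) → All (_< N) (supp X)
entriesBelow-Placed {N} {X} P T ≤N = All.zipWith (λ (x≤N , N≢x) → ≤∧≢⇒< x≤N (N≢x ∘ sym)) (≤N′ , N∉X)
  where
  ≤N′ : All (_≤ N) (supp X)
  ≤N′ = All.tail (All-resp-↭ (supp-Placed P) ≤N)
  N∉X : All (N ≢_) (supp X)
  N∉X = AllPairs.head (Unique-resp-↭ (supp-Placed P) (MultilinearTableau.distinct T))

ColumnsIncrease : List (List ℕ) → Set
ColumnsIncrease T = ∀ i j x y → entry T i j ≡ just x → entry T (suc i) j ≡ just y → x < y

ColumnsIncrease-++⁻ʳ : ∀ U {V} → ColumnsIncrease (U ++ V) → ColumnsIncrease V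
ColumnsIncrease-++⁻ʳ []      cols = cols
ColumnsIncrease-++⁻ʳ (u ∷ U) cols = ColumnsIncrease-++⁻ʳ U (cols ∘ suc)

rowsAbove-longer : ∀ U p N R → NonIncreasingLengths (U ++ (p ∷ʳ N) ∷ R) → All (λ u → length p < length u) U
rowsAbove-longer U p N R lin =
  All.map (subst (_≤ _) (length-∷ʳ p N))
    (AllPairs-++-before U (Linked.Linked⇒AllPairs (λ {r} {s} {t} → ≥ᴸ-trans {r} {s} {t}) lin))

rowsBelow-shorter : ∀ U p N R → MultilinearTableau (U ++ (p ∷ʳ N) ∷ R) →
  All (_≤ N) (supp (U ++ (p ∷ʳ N) ∷ R)) → All (λ r → length r ≤ length p) R
rowsBelow-shorter U p N []      T ≤N = []
rowsBelow-shorter U p N (r ∷ R) T ≤N =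
  Linked.Linked⇒All (λ {r} {s} {t} → ≥ᴸ-trans {r} {s} {t}) {v = p} r≤p
    (Linked.tail (Linked-++⁻ʳ U (proj₂ (MultilinearTableau.shape T))))
  where
  r≤p : length r ≤ length p
  r≤p with length r ≤? length p
  ... | yes r≤p = r≤p
  ... | no r≰p with v , atv ← <⇒at-just r (length p) (≰⇒> r≰p) = ⊥-elim (<⇒≱ N<v v≤N)
    where
    v≤N : v ≤ N
    v≤N with _ ∷ r≤N ∷ _ ← All.++⁻ʳ U (All.concat⁻ ≤N) = All-at r (length p) r≤N atv
    N<v : N < v
    N<v = ColumnsIncrease-++⁻ʳ U (MultilinearTableau.colsIncr T) 0 (length p) N v (at-∷ʳ-length p N) atv

record CellRemoval (N : ℕ) (T : List (List ℕ)) : Set where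
  field
    j          : ℕ
    T′         : List (List ℕ)
    placed     : Placed N T′ j T
    shortBelow : ShortBelow placed
    tableau′   : MultilinearTableau T′
    below′     : All (_< N) (supp T′)

removeMax-cell : ∀ {N} T → MultilinearTableau T → All (_≤ N) (supp T) → N ∈ supp T → CellRemoval N T
removeMax-cell {N} T tab ≤N N∈T with max-at-rowEnd T (MultilinearTableau.rowsIncr tab) ≤N N∈T
... | U , [] , [] , refl = record
  { j = 0 ; T′ = U ; placed = placed ; shortBelow = ShortBelow-newRow U U≢0
  ; tableau′ = multilinear-Placed⁻ placed tab (All.++⁻ˡ U ne , Linked-++⁻ˡ U lin) (All.++⁻ˡ U rowsIncr)
  ; below′ = entriesBelow-Placed placed tab ≤N }
  where
  open MultilinearTableau tab
  ne : All NonEmpty (U ++ (N ∷ []) ∷ [])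
  ne = proj₁ shape
  lin : NonIncreasingLengths (U ++ (N ∷ []) ∷ [])
  lin = proj₂ shape
  U≢0 : All (λ u → length u ≢ 0) U
  U≢0 = All.map (λ 0<u u≡0 → <-irrefl (sym u≡0) 0<u) (rowsAbove-longer U [] N [] lin)
  placed : Placed N U 0 (U ++ (N ∷ []) ∷ [])
  placed = Placed-newRow U U≢0
... | U , [] , r ∷ R , refl
  with nonEmpty ← All.head (All.tail (All.++⁻ʳ U (proj₁ (MultilinearTableau.shape tab))))
  with () ← All.head (rowsBelow-shorter U [] N (r ∷ R) tab ≤N)
... | U , x ∷ p , R , refl = record
  { j = length (x ∷ p) ; T′ = U ++ (x ∷ p) ∷ R ; placed = placed
  ; shortBelow = ShortBelow-++ U U≢j (here refl) R≤p
  ; tableau′ = multilinear-Placed⁻ placed tab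
      ( All-++-replace U ne nonEmpty
      , Linked-++-replace U lin (λ {u} xN≤u → ≤-trans (n≤1+n _) (subst (_≤ length u) (length-∷ʳ (x ∷ p) N) xN≤u))
                                lin′ )
      (All-++-replace U rowsIncr (Linked-++⁻ˡ (x ∷ p) (All.head (All.++⁻ʳ U rowsIncr))))
  ; below′ = entriesBelow-Placed placed tab ≤N }
  where
  open MultilinearTableau tab
  ne : All NonEmpty (U ++ ((x ∷ p) ∷ʳ N) ∷ R)
  ne = proj₁ shape
  lin : NonIncreasingLengths (U ++ ((x ∷ p) ∷ʳ N) ∷ R)
  lin = proj₂ shape
  R≤p : All (λ r → length r ≤ length (x ∷ p)) R
  R≤p = rowsBelow-shorter U (x ∷ p) N R tab ≤N
  U≢j : All (λ u → length u ≢ length (x ∷ p)) U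
  U≢j = All.map (λ p<u u≡p → <-irrefl (sym u≡p) p<u) (rowsAbove-longer U (x ∷ p) N R lin)
  placed : Placed N (U ++ (x ∷ p) ∷ R) (length (x ∷ p)) (U ++ ((x ∷ p) ∷ʳ N) ∷ R)
  placed = Placed-++ U U≢j (here refl)
  lin′ : NonIncreasingLengths ((x ∷ p) ∷ R)
  lin′ = Linked-∷⁺ R≤p (Linked.tail (Linked-++⁻ʳ U lin))

-- Counting

record Enumeration (T : List (List ℕ)) : Set where
  field
    partitions   : List (List (List ℕ))
    unique       : Unique partitions
    complete     : ∀ A → (A ∈ partitions) ⇔ (SetPartitionOf (supp T) A × 𝒯 A ≡ T)
    count        : length partitions ≡ c T
    blockLengths : ∀ A → A ∈ partitions → ∀ l → countLength A (suc l) ≡ countLength T (suc l)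

enumeration-[] : Enumeration []
enumeration-[] = record
  { partitions = [] ∷ [] ; unique = [] ∷ [] ; complete = λ A → mk⇔ to from ; count = refl
  ; blockLengths = λ { A (here refl) l → refl } }
  where
  to : ∀ {A} → A ∈ [] ∷ [] → SetPartitionOf [] A × 𝒯 A ≡ []
  to (here refl) = ([] , [] , Linked.[] , ↭-refl) , refl
  noBlocks : ∀ A → All NonEmpty A → concat A ≡ [] → A ≡ []
  noBlocks []            _        _  = refl
  noBlocks ([] ∷ A)      (() ∷ _) _
  noBlocks ((x ∷ b) ∷ A) _        ()
  from : ∀ {A} → SetPartitionOf [] A × 𝒯 A ≡ [] → A ∈ [] ∷ []
  from {A} ((ne , _ , _ , A↭[]) , _) = here (noBlocks A ne (↭-empty-inv A↭[]))

module Extension {N T} (removal : CellRemoval N T) (E : Enumeration (CellRemoval.T′ removal)) where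
  open CellRemoval removal
  open Enumeration E

  extensions : List (List ℕ) → List (List (List ℕ))
  extensions A′ = map (λ k → appendTo A′ k N) (slots A′ j)

  partitionOf-T′ : ∀ {A′} → A′ ∈ partitions → SetPartitionOf (supp T′) A′ × 𝒯 A′ ≡ T′
  partitionOf-T′ {A′} = Equivalence.to (complete A′)

  below : ∀ A′ → concat A′ ↭ supp T′ → All (_< N) (concat A′)
  below A′ A′↭ = All-resp-↭ (↭-sym A′↭) below′

  nonEmpty-below : ∀ {A′} → A′ ∈ partitions → All NonEmpty A′ × EntriesBelow N A′
  nonEmpty-below {A′} A′∈ with (ne , _ , _ , A′↭) , _ ← partitionOf-T′ A′∈ =
    ne , All.concat⁻ (below A′ A′↭)

  extensions-separate : ∀ {A′ B′ A} → A′ ∈ partitions → B′ ∈ partitions →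
    A ∈ extensions A′ → A ∈ extensions B′ → A′ ≡ B′
  extensions-separate {A′} {B′} A′∈ B′∈ A∈ A∈′
    with k , k∈ , refl ← ∈-map⁻ _ A∈ | l , l∈ , eq ← ∈-map⁻ _ A∈′ =
    proj₁ (appendTo-injective A′ B′ k l eq (proj₁ (nonEmpty-below A′∈)) (proj₁ (nonEmpty-below B′∈))
             (proj₂ (nonEmpty-below A′∈)) (proj₂ (nonEmpty-below B′∈))
             (proj₂ (∈-slots⁻ A′ j k∈)) (proj₂ (∈-slots⁻ B′ j l∈)))

  extensions-unique : ∀ {A′} → A′ ∈ partitions → Unique (extensions A′)
  extensions-unique {A′} A′∈ = Unique-map⁺-on injective (slots-unique A′ j)
    where
    injective : ∀ {k l} → k ∈ slots A′ j → l ∈ slots A′ j → appendTo A′ k N ≡ appendTo A′ l N → k ≡ l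
    injective k∈ l∈ eq = let ne , bl = nonEmpty-below A′∈ in
      proj₂ (appendTo-injective A′ A′ _ _ eq ne ne bl bl (proj₂ (∈-slots⁻ A′ j k∈)) (proj₂ (∈-slots⁻ A′ j l∈)))

  rowsT′ : All NonEmpty T′
  rowsT′ = proj₁ (MultilinearTableau.shape tableau′)

  sameLengths : ∀ {A′} → A′ ∈ partitions → ∀ l → countLength A′ l ≡ countLength T′ l
  sameLengths A′∈ zero    =
    trans (countLength-zero _ (proj₁ (nonEmpty-below A′∈))) (sym (countLength-zero T′ rowsT′))
  sameLengths A′∈ (suc l) = blockLengths _ A′∈ l

  count′ : length (concatMap extensions partitions) ≡ c T
  count′ = begin
    length (concatMap extensions partitions)
      ≡⟨ length-concatMap-const extensions m partitions (λ {A′} A′∈ →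
           trans (length-map _ (slots A′ j)) (trans (length-slots A′ j) (cong (_+ δ 0 j) (sameLengths A′∈ j)))) ⟩
    length partitions * m ≡⟨ cong (_* m) count ⟩
    c T′ * m              ≡⟨ c-Placed placed shortBelow rowsT′ (All.concat⁻ below′) ⟨
    c T ∎
    where
    open ≡-Reasoning
    m : ℕ
    m = countLength T′ j + δ 0 j

  supp-T : supp T ↭ N ∷ supp T′
  supp-T = supp-Placed placed

  ≤N : All (_≤ N) (supp T)
  ≤N = All-resp-↭ (↭-sym supp-T) (≤-refl ∷ All.map <⇒≤ below′)

  N∈T : N ∈ supp T
  N∈T = ∈-resp-↭ (↭-sym supp-T) (here refl)

  ∈-extensions⁻ : ∀ {A} → A ∈ concatMap extensions partitions →
    ∃[ A′ ] ∃[ k ] (A′ ∈ partitions × k ∈ slots A′ j × A ≡ appendTo A′ k N)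
  ∈-extensions⁻ A∈ with A′ , A′∈ , A∈ext ← find (∈-concatMap⁻ extensions A∈)
                   with k , k∈ , eq ← ∈-map⁻ _ A∈ext = A′ , k , A′∈ , k∈ , eq

  to : ∀ {A} → A ∈ concatMap extensions partitions → SetPartitionOf (supp T) A × 𝒯 A ≡ T
  to A∈ with A′ , k , A′∈ , k∈ , refl ← ∈-extensions⁻ A∈
    with (ne′ , incr′ , hl′ , A′↭) , 𝒯A′≡T′ ← partitionOf-T′ A′∈ | rowLen≡j , _ ← ∈-slots⁻ A′ j k∈ =
    ( appendTo-nonEmpty A′ k N ne′
    , appendTo-increasing A′ k N incr′ (All.concat⁻ (below A′ A′↭))
    , appendTo-headLt A′ k N hl′ ne′ (All.concat⁻ (below A′ A′↭))
    , ↭-trans (concat-appendTo-↭ A′ k N) (↭-trans (prep N A′↭) (↭-sym supp-T)) )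
    , Placed-functional (subst₂ (λ X i → Placed N X i _) 𝒯A′≡T′ rowLen≡j (𝒯-appendTo A′ k N (below A′ A′↭)))
                        placed

  appended-∈ : ∀ {A′ k} → k ≤ length A′ → All NonEmpty A′ → All (Linked _<_) A′ → Linked headLt A′ →
    concat (appendTo A′ k N) ↭ supp T → 𝒯 (appendTo A′ k N) ≡ T →
    appendTo A′ k N ∈ concatMap extensions partitions
  appended-∈ {A′} {k} k≤ ne′ incr′ hl′ A↭ 𝒯A≡T =
    ∈-concatMap⁺ extensions (lose A′∈ (∈-map⁺ _ (∈-slots⁺ A′ j k (proj₂ restricted) k≤)))
    where
    A′↭ : concat A′ ↭ supp T′
    A′↭ = drop-∷ (↭-trans (↭-sym (concat-appendTo-↭ A′ k N)) (↭-trans A↭ supp-T))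
    restricted : 𝒯 A′ ≡ T′ × rowLen A′ k ≡ j
    restricted = Placed-injective (𝒯-appendTo A′ k N (below A′ A′↭)) placed 𝒯A≡T
                   (𝒯-nonEmpty A′) rowsT′ (𝒯-All A′ (below A′ A′↭)) (All.concat⁻ below′)
    A′∈ : A′ ∈ partitions
    A′∈ = Equivalence.from (complete A′) ((ne′ , incr′ , hl′ , A′↭) , proj₁ restricted)

  from : ∀ {A} → SetPartitionOf (supp T) A × 𝒯 A ≡ T → A ∈ concatMap extensions partitions
  from {A} ((ne , incr , hl , A↭) , 𝒯A≡T)
    with removeMax-block A ne incr hl (All-resp-↭ (↭-sym A↭) ≤N) (∈-resp-↭ (↭-sym A↭) N∈T)
  ... | record { appended = refl ; k≤ = k≤ ; nonEmpty′ = ne′ ; increasing′ = incr′ ; headLt′ = hl′ } =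
    appended-∈ k≤ ne′ incr′ hl′ A↭ 𝒯A≡T

  blockLengths′ : ∀ A → A ∈ concatMap extensions partitions →
    ∀ l → countLength A (suc l) ≡ countLength T (suc l)
  blockLengths′ A A∈ l with A′ , k , A′∈ , k∈ , refl ← ∈-extensions⁻ A∈
                       with i , T≡ , rowLen≡j , _ ← Placed⇒appendTo placed =
    +-cancelʳ-≡ (δ j (suc l)) _ _ (begin
      countLength (appendTo A′ k N) (suc l) + δ j (suc l)  ≡⟨ countLength-appendTo-at A′ k (proj₁ (∈-slots⁻ A′ j k∈)) ⟩
      countLength A′ (suc l) + δ (suc j) (suc l)           ≡⟨ cong (_+ δ (suc j) (suc l)) (blockLengths A′ A′∈ l) ⟩
      countLength T′ (suc l) + δ (suc j) (suc l)           ≡⟨ countLength-appendTo-at T′ i rowLen≡j ⟨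
      countLength (appendTo T′ i N) (suc l) + δ j (suc l)  ≡⟨ cong (λ Z → countLength Z (suc l) + δ j (suc l)) T≡ ⟨
      countLength T (suc l) + δ j (suc l)                  ∎)
    where
    open ≡-Reasoning
    countLength-appendTo-at : ∀ X k → rowLen X k ≡ j →
      countLength (appendTo X k N) (suc l) + δ j (suc l) ≡ countLength X (suc l) + δ (suc j) (suc l)
    countLength-appendTo-at X k refl = countLength-appendTo X k N l

  enumeration : Enumeration T
  enumeration = record
    { partitions = concatMap extensions partitions
    ; unique = Unique-concatMap⁺ extensions unique extensions-unique extensions-separate
    ; complete = λ A → mk⇔ to from
    ; count = count′
    ; blockLengths = blockLengths′ }

max∈ : ∀ x xs → max x xs ∈ x ∷ xs
max∈ x xs with argmax-sel (λ n → n) x xs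
... | inj₁ max≡x  = here max≡x
... | inj₂ max∈xs = there max∈xs

enumerate : ∀ n T → length (supp T) ≡ n → MultilinearTableau T → Enumeration T
enumerate _       []      _   _   = enumeration-[]
enumerate zero    (r ∷ R) len tab with nonEmpty ∷ _ ← proj₁ (MultilinearTableau.shape tab) with () ← len
enumerate (suc n) (r ∷ R) len tab with nonEmpty {x} {r′} ∷ _ ← proj₁ (MultilinearTableau.shape tab) =
  Extension.enumeration removal (enumerate n T′ len′ tableau′)
  where
  rest : List ℕ
  rest = r′ ++ concat R
  N : ℕ
  N = max x rest
  ≤N : All (_≤ N) (x ∷ rest)
  ≤N = ⊥≤max x rest ∷ xs≤max x rest
  removal : CellRemoval N ((x ∷ r′) ∷ R)
  removal = removeMax-cell ((x ∷ r′) ∷ R) tab ≤N (max∈ x rest)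
  open CellRemoval removal
  len′ : length (supp T′) ≡ n
  len′ = suc-injective (trans (sym (↭-length (supp-Placed placed))) len)

theorem2p10 : (T : List (List ℕ)) → MultilinearTableau T →
    ∃[ L ] (Unique L
      × (∀ A → (A ∈ L) ⇔ (SetPartitionOf (supp T) A × 𝒯 A ≡ T))
      × length L ≡ c T)
theorem2p10 T tab = partitions , unique , complete , count
  where open Enumeration (enumerate (length (supp T)) T refl tab)
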